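{- Let $P=(X,\leq_P)$ be a finite poset with at least two points and no isolated points, and let $C=(Z,\leq_C)$ be a connected poset of height one with $Z\subseteq E(P)$ which is the induced subposet of $P$ on $Z$. Let $C_{\mathcal{F}(P)}$ be the poset on $Z$ whose strict relations are the pairs $(a,v)$ with $a<_C v$ such that $a,v\in F$ for some $F\in\mathcal{F}(P)$, and for $a\in L(C)$, $v\in U(C)$ let $N_{a,v}$ be the poset on $Z$ whose strict relations are $(L(C)\times\{v\})\cup(\{a\}\times U(C))$. Then there exists a $Z$-separating homomorphism $\phi:\mathfrak{F}(P)\to\mathfrak{C}(C)$ whose image $\phi[\mathcal{F}(P)]$ is a clique if and only if there exist $a\in L(C)$ and $v\in U(C)$ such that $C_{\mathcal{F}(P)}$ is a subposet of $N_{a,v}$ (i.e. every strict relation of $C_{\mathcal{F}(P)}$ is a strict relation of $N_{a,v}$).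
   Context: Posets: for $P=(X,\leq_P)$, $L(P)$, $U(P)$ are the minimal and maximal points, $E(P):=L(P)\cup U(P)$; ${\downarrow}_P y:=\{x: x\leq_P y\}$, ${\uparrow}_P y:=\{x:y\leq_P x\}$, $[x,y]_P:={\uparrow}_P x\cap{\downarrow}_P y$. A 4-crown in $P$ is a set $\{a,b,v,w\}$ with $a,b<_P v,w$, $a\parallel b$, $v\parallel w$; its inner is $[a,v]_P\cap[b,w]_P$, and it is improper if the inner is nonempty. 4-crown bundles: $\mathcal{C}_{imp}(P)$ is the set of improper 4-crowns contained in $E(P)$; $\mathcal{M}(P)$ is the union of the inners of all members of $\mathcal{C}_{imp}(P)$; for $m\in\mathcal{M}(P)$, $\Xi(m) := (L(P)\cap{\downarrow}_P m)\cup(U(P)\cap{\uparrow}_P m)$; $\mathcal{F}(P)$ is the set of inclusion-maximal members of $\{\Xi(m): m\in\mathcal{M}(P)\}$. $\mathfrak{F}(P)$ is the multigraph with vertex set $\mathcal{F}(P)$ having an L-edge between $F,G$ (loops allowed) iff $L(P)\cap F\cap G\neq\emptyset$ and a U-edge iff $U(P)\cap F\cap G\neq\emptyset$. For $C$ connected of height one (so $Z=L(C)\cup U(C)$ and $x<_C y$ implies $x\in L(C)$, $y\in U(C)$): for $a\in L(C)$, $\curlyvee(a):=\{\{a\}\cup N:\emptyset\neq N\subseteq U(C)\}$, $\mathcal{L}:=\bigcup_{a\in L(C)}\curlyvee(a)$; for $v\in U(C)$, $\curlywedge(v):=\{\{v\}\cup N:\emptyset\neq N\subseteq L(C)\}$,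 $\mathcal{U}:=\bigcup_{v\in U(C)}\curlywedge(v)$. $\mathcal{C}_0(C):=\{S\in\mathcal{L}:\exists a\in L(C),\ S\subseteq{\uparrow}_C a\}\cup\{S\in\mathcal{U}:\exists v\in U(C),\ S\subseteq{\downarrow}_C v\}$. $\mathfrak{C}(C)$ is the multigraph with vertex set $\mathcal{C}_0(C)$ having an L-edge between $S,T$ iff $L(C)\cap S\cap T\neq\emptyset$ and a U-edge iff $U(C)\cap S\cap T\neq\emptyset$. A clique in $\mathfrak{C}(C)$ is a subset of $\mathcal{C}_0(C)$ any two of whose vertices are joined both by an L-edge and by a U-edge. A homomorphism $\phi:\mathfrak{F}(P)\to\mathfrak{C}(C)$ is a map $\mathcal{F}(P)\to\mathcal{C}_0(C)$ such that an L-edge (U-edge) between $F$ and $G$ implies an L-edge (U-edge) between $\phi(F)$ and $\phi(G)$. It is separating if there is an injective $i:Z\to E(P)$ with $i[L(C)]\subseteq L(P)$, $i[U(C)]\subseteq U(P)$ such that for all $a\in L(C)$, $v\in U(C)$, $F\in\mathcal{F}(P)$: ($i(a)\in F$ and $\phi(F)\in\mathcal{L}$) implies $\phi(F)\in\curlyvee(a)$, and ($i(v)\in F$ and $\phi(F)\in\mathcal{U}$) implies $\phi(F)\in\curlywedge(v)$; such $i$ is said to belong to $\phi$. $\phi$ is $Z$-separating if $Z\subseteq E(P)$ and the belonging $i$ satisfies $i[Z]=Z$. -}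

module Defs where

open import Data.Nat using (ℕ)
open import Data.Fin using (Fin)
open import Data.Fin.Subset using (Subset; _∈_; _∪_; ⁅_⁆; Nonempty)
open import Data.Product using (_×_; _,_; ∃; ∃-syntax; Σ)
open import Data.Sum using (_⊎_)
open import Relation.Binary.PropositionalEquality using (_≡_; _≢_)
open import Relation.Binary.Structures using (IsDecPartialOrder)
open import Relation.Nullary using (¬_)

-- A finite poset on the carrier Fin n (order decidable, as every finite
-- poset classically is).
record FinPoset (n : ℕ) : Set₁ where
  field
    _≼_ : Fin n → Fin n → Set
    isDecPartialOrder : IsDecPartialOrder _≡_ _≼_

module _ {n : ℕ} (P : FinPoset n) where
  open FinPoset P

  _≺_ : Fin n → Fin n → Set
  x ≺ y = x ≼ y × x ≢ y

  _∥_ : Fin n → Fin n → Set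
  x ∥ y = ¬ (x ≼ y) × ¬ (y ≼ x)

  Comparable : Fin n → Fin n → Set
  Comparable x y = x ≼ y ⊎ y ≼ x

  NoIsolated : Set
  NoIsolated = ∀ x → ∃[ y ] (y ≢ x × Comparable x y)

  InL : Fin n → Set
  InL x = ∀ y → y ≼ x → y ≡ x

  InU : Fin n → Set
  InU x = ∀ y → x ≼ y → y ≡ x

  InE : Fin n → Set
  InE x = InL x ⊎ InU x

  IsFourCrown : Fin n → Fin n → Fin n → Fin n → Set
  IsFourCrown a b v w =
    a ≺ v × a ≺ w × b ≺ v × b ≺ w × a ∥ b × v ∥ w

  InInner : Fin n → Fin n → Fin n → Fin n → Fin n → Set
  InInner a b v w m = (a ≼ m × m ≼ v) × (b ≼ m × m ≼ w)

  InM : Fin n → Set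
  InM m = ∃[ a ] ∃[ b ] ∃[ v ] ∃[ w ]
    ((InE a × InE b × InE v × InE w) × IsFourCrown a b v w × InInner a b v w m)

  IsXi : Fin n → Subset n → Set
  IsXi m F = ∀ x →
    (x ∈ F → (InL x × x ≼ m) ⊎ (InU x × m ≼ x)) ×
    ((InL x × x ≼ m) ⊎ (InU x × m ≼ x) → x ∈ F)

  IsXiSet : Subset n → Set
  IsXiSet F = ∃[ m ] (InM m × IsXi m F)

  InFP : Subset n → Set
  InFP F = IsXiSet F × (∀ G → IsXiSet G → (∀ x → x ∈ F → x ∈ G) → F ≡ G)

  LEdgeF : Subset n → Subset n → Set
  LEdgeF F G = ∃[ x ] (InL x × x ∈ F × x ∈ G)

  UEdgeF : Subset n → Subset n → Set
  UEdgeF F G = ∃[ x ] (InU x × x ∈ F × x ∈ G)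

  module _ (Z : Subset n) where

    _≼C_ : Fin n → Fin n → Set
    x ≼C y = x ∈ Z × y ∈ Z × x ≼ y

    _≺C_ : Fin n → Fin n → Set
    x ≺C y = x ∈ Z × y ∈ Z × x ≺ y

    InLC : Fin n → Set
    InLC x = x ∈ Z × (∀ y → y ∈ Z → y ≼ x → y ≡ x)

    InUC : Fin n → Set
    InUC x = x ∈ Z × (∀ y → y ∈ Z → x ≼ y → y ≡ x)

    data PathC : Fin n → Fin n → Set where
      here : ∀ {x} → PathC x x
      step : ∀ {x y z} → Comparable x y → y ∈ Z → PathC y z → PathC x z

    ConnectedC : Set
    ConnectedC = (∃[ x ] (x ∈ Z)) × (∀ x y → x ∈ Z → y ∈ Z → PathC x y)

    HeightOneC : Set
    HeightOneC = (∃[ x ] ∃[ y ] (x ≺C y)) ×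
                 ¬ (∃[ x ] ∃[ y ] ∃[ z ] (x ≺C y × y ≺C z))

    Curlyvee : Fin n → Subset n → Set
    Curlyvee a S = ∃[ N ] (Nonempty N × (∀ x → x ∈ N → InUC x) × S ≡ ⁅ a ⁆ ∪ N)

    Curlywedge : Fin n → Subset n → Set
    Curlywedge v S = ∃[ N ] (Nonempty N × (∀ x → x ∈ N → InLC x) × S ≡ ⁅ v ⁆ ∪ N)

    InLfam : Subset n → Set
    InLfam S = ∃[ a ] (InLC a × Curlyvee a S)

    InUfam : Subset n → Set
    InUfam S = ∃[ v ] (InUC v × Curlywedge v S)

    InC0 : Subset n → Set
    InC0 S = (InLfam S × ∃[ a ] (InLC a × (∀ x → x ∈ S → a ≼C x)))
           ⊎ (InUfam S × ∃[ v ] (InUC v × (∀ x → x ∈ S → x ≼C v)))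

    LEdgeC : Subset n → Subset n → Set
    LEdgeC S T = ∃[ x ] (InLC x × x ∈ S × x ∈ T)

    UEdgeC : Subset n → Subset n → Set
    UEdgeC S T = ∃[ x ] (InUC x × x ∈ S × x ∈ T)

    -- φ : 𝔉(P) → ℭ(C) is a homomorphism (φ given as a map on all subsets;
    -- only its restriction to 𝓕(P) matters)
    IsHom : (Subset n → Subset n) → Set
    IsHom φ =
      (∀ F → InFP F → InC0 (φ F)) ×
      (∀ F G → InFP F → InFP G → LEdgeF F G → LEdgeC (φ F) (φ G)) ×
      (∀ F G → InFP F → InFP G → UEdgeF F G → UEdgeC (φ F) (φ G))

    BelongsTo : (Subset n → Subset n) → (Fin n → Fin n) → Set
    BelongsTo φ i =
      (∀ x y → x ∈ Z → y ∈ Z → i x ≡ i y → x ≡ y) ×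
      (∀ x → x ∈ Z → InE (i x)) ×
      (∀ a → InLC a → InL (i a)) ×
      (∀ v → InUC v → InU (i v)) ×
      (∀ a F → InLC a → InFP F → i a ∈ F → InLfam (φ F) → Curlyvee a (φ F)) ×
      (∀ v F → InUC v → InFP F → i v ∈ F → InUfam (φ F) → Curlywedge v (φ F))

    ZSeparating : (Subset n → Subset n) → Set
    ZSeparating φ =
      (∀ x → x ∈ Z → InE x) ×
      ∃[ i ] (BelongsTo φ i ×
              (∀ x → x ∈ Z → i x ∈ Z) ×
              (∀ y → y ∈ Z → ∃[ x ] (x ∈ Z × i x ≡ y)))

    ImageClique : (Subset n → Subset n) → Set
    ImageClique φ = ∀ F G → InFP F → InFP G →
      LEdgeC (φ F) (φ G) × UEdgeC (φ F) (φ G)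

    CFRel : Fin n → Fin n → Set
    CFRel x y = x ≺C y × ∃[ F ] (InFP F × x ∈ F × y ∈ F)

    NRel : Fin n → Fin n → Fin n → Fin n → Set
    NRel a v x y = (InLC x × y ≡ v) ⊎ (x ≡ a × InUC y)

{-# OPTIONS --safe #-}

-- Forward: in a clique image every lower bound a₀ of an L-type image φ F ∈ ⋎(a₀) lies in
-- every image, so all L-type images share one bottom a₀, and dually all U-type images share
-- one top v₀. If a < v in C_𝓕(P) with a, v ∈ F, separation puts the preimage of a in φ F
-- when φ F is L-type, forcing a = i a₀; when φ F is U-type it forces v = i v₀. Hence
-- C_𝓕(P) ⊆ N_{i a₀, i v₀}.
--
-- Backward: suppose C_𝓕(P) ⊆ N_{a,v}. If C has an edge b < t with a second point u above b
-- and a second point c below t, let i exchange a ↔ b and v ↔ t, and send F to {b,t,u} when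
-- a is the only minimal point of C in F, and to {t,b,c} otherwise. In the second case F
-- contains a minimal point x ≠ a, and every maximal point y of C in F satisfies x < y in
-- C_𝓕(P), so y = v: this is what makes the U-type image {t,b,c} separating. Without such an
-- edge C is a star or a single edge, and a constant φ with i = id works.

module Submission where

open import Defs
open import Data.Nat using (ℕ; _≤_)
open import Data.Fin.Subset using (Subset; _∈_; _∪_; ⁅_⁆)
open import Data.Product using (_×_; ∃-syntax; _,_; proj₁; proj₂)
open import Function.Bundles using (_⇔_; Injection; mk⇔)

open import Data.Bool using () renaming (_≟_ to _≟ᵇ_)
open import Data.Empty using (⊥-elim)
open import Data.Fin using (Fin; _≟_)
open import Data.Fin.Permutation using (Permutation′; _⟨$⟩ʳ_; _⟨$⟩ˡ_; inverseʳ; transpose; _∘ₚ_)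
import Data.Fin.Permutation as Permutation
import Data.Fin.Permutation.Components as PC
open import Data.Fin.Properties using (any?; all?)
open import Data.Fin.Subset.Properties using (_∈?_; x∈⁅x⁆; x∈⁅y⁆⇒x≡y; x∈p∪q⁻; x∈p∪q⁺; anySubset?)
open import Data.Sum using (_⊎_; inj₁; inj₂)
open import Data.Vec.Properties using (≡-dec)
open import Function using (id; _∘_)
open import Function.Properties.Inverse using (↔⇒↣)
open import Level using (Level)
open import Relation.Binary.PropositionalEquality using (_≡_; _≢_; refl; sym; trans; cong; subst)
open import Relation.Binary.Structures using (IsDecPartialOrder)
open import Relation.Nullary using (¬_; Dec; yes; no)
open import Relation.Nullary.Decidable using (_×-dec_; _→-dec_; _⊎-dec_; ¬?; decidable-stable; map′)
open import Relation.Unary using (Pred; Decidable)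

private
  variable
    ℓ : Level

module _ {n : ℕ} where

  transpose-matchʳ : (i j : Fin n) → PC.transpose i j j ≡ i
  transpose-matchʳ i j with j ≟ i
  ... | yes j≡i = j≡i
  ... | no _ with j ≟ j
  ...   | yes _ = refl
  ...   | no j≢j = ⊥-elim (j≢j refl)

  transpose-fix : ∀ {i j k : Fin n} → k ≢ i → k ≢ j → PC.transpose i j k ≡ k
  transpose-fix {i} {j} {k} k≢i k≢j with k ≟ i
  ... | yes k≡i = ⊥-elim (k≢i k≡i)
  ... | no _ with k ≟ j
  ...   | yes k≡j = ⊥-elim (k≢j k≡j)
  ...   | no _ = refl

  transpose-preserves : (R : Pred (Fin n) ℓ) {i j k : Fin n} →
                        R i → R j → R k → R (PC.transpose i j k)
  transpose-preserves R {i} {j} {k} Ri Rj Rk with k ≟ i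
  ... | yes _ = Rj
  ... | no _ with k ≟ j
  ...   | yes _ = Ri
  ...   | no _ = Rk

  allSubset? : {R : Pred (Subset n) ℓ} → Decidable R → Dec (∀ S → R S)
  allSubset? R? = map′ (λ ∄¬R S → decidable-stable (R? S) (λ ¬RS → ∄¬R (S , ¬RS)))
                       (λ ∀R (S , ¬RS) → ¬RS (∀R S))
                       (¬? (anySubset? (¬? ∘ R?)))

  pair : Fin n → Fin n → Subset n
  pair p q = ⁅ p ⁆ ∪ ⁅ q ⁆

  triple : Fin n → Fin n → Fin n → Subset n
  triple p q r = ⁅ p ⁆ ∪ pair q r

  module _ {p q r : Fin n} where

    p∈triple : p ∈ triple p q r
    p∈triple = x∈p∪q⁺ (inj₁ (x∈⁅x⁆ p))

    q∈triple : q ∈ triple p q r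
    q∈triple = x∈p∪q⁺ (inj₂ (x∈p∪q⁺ (inj₁ (x∈⁅x⁆ q))))

    r∈triple : r ∈ triple p q r
    r∈triple = x∈p∪q⁺ (inj₂ (x∈p∪q⁺ (inj₂ (x∈⁅x⁆ r))))

  pair-all : (R : Pred (Fin n) ℓ) {p q : Fin n} → R p → R q → ∀ x → x ∈ pair p q → R x
  pair-all R {p} {q} Rp Rq x x∈pq with x∈p∪q⁻ ⁅ p ⁆ ⁅ q ⁆ x∈pq
  ... | inj₁ x∈p = subst R (sym (x∈⁅y⁆⇒x≡y p x∈p)) Rp
  ... | inj₂ x∈q = subst R (sym (x∈⁅y⁆⇒x≡y q x∈q)) Rq

  triple-all : (R : Pred (Fin n) ℓ) {p q r : Fin n} → R p → R q → R r →
               ∀ x → x ∈ triple p q r → R x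
  triple-all R {p} {q} {r} Rp Rq Rr x x∈pqr with x∈p∪q⁻ ⁅ p ⁆ (pair q r) x∈pqr
  ... | inj₁ x∈p = subst R (sym (x∈⁅y⁆⇒x≡y p x∈p)) Rp
  ... | inj₂ x∈qr = pair-all R Rq Rr x x∈qr

module _ {n : ℕ} (P : FinPoset n) where
  open FinPoset P
  open IsDecPartialOrder isDecPartialOrder using () renaming (_≤?_ to _≼?_; trans to ≼-trans)

  InL? : Decidable (InL P)
  InL? x = all? λ y → (y ≼? x) →-dec (y ≟ x)

  InU? : Decidable (InU P)
  InU? x = all? λ y → (x ≼? y) →-dec (y ≟ x)

  InE? : Decidable (InE P)
  InE? x = InL? x ⊎-dec InU? x

  _≺?_ : ∀ x y → Dec (_≺_ P x y)
  x ≺? y = (x ≼? y) ×-dec ¬? (x ≟ y)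

  _∥?_ : ∀ x y → Dec (_∥_ P x y)
  x ∥? y = ¬? (x ≼? y) ×-dec ¬? (y ≼? x)

  InM? : Decidable (InM P)
  InM? m = any? λ a → any? λ b → any? λ v → any? λ w →
    (InE? a ×-dec InE? b ×-dec InE? v ×-dec InE? w) ×-dec
    (a ≺? v ×-dec a ≺? w ×-dec b ≺? v ×-dec b ≺? w ×-dec a ∥? b ×-dec v ∥? w) ×-dec
    (((a ≼? m) ×-dec (m ≼? v)) ×-dec ((b ≼? m) ×-dec (m ≼? w)))

  IsXi? : ∀ m → Decidable (IsXi P m)
  IsXi? m F = all? λ x → ((x ∈? F) →-dec below-or-above? x) ×-dec (below-or-above? x →-dec (x ∈? F))
    where
    below-or-above? : Decidable (λ x → (InL P x × x ≼ m) ⊎ (InU P x × m ≼ x))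
    below-or-above? x = (InL? x ×-dec (x ≼? m)) ⊎-dec (InU? x ×-dec (m ≼? x))

  IsXiSet? : Decidable (IsXiSet P)
  IsXiSet? F = any? λ m → InM? m ×-dec IsXi? m F

  InFP? : Decidable (InFP P)
  InFP? F = IsXiSet? F ×-dec allSubset? λ G →
    IsXiSet? G →-dec (all? (λ x → (x ∈? F) →-dec (x ∈? G)) →-dec ≡-dec _≟ᵇ_ F G)

  𝓕-ordered : ∀ {F x y} → InFP P F → x ∈ F → y ∈ F → ¬ InU P x → ¬ InL P y → x ≼ y
  𝓕-ordered {x = x} {y} ((m , _ , Ξ) , _) x∈F y∈F x∉U y∉L
    with proj₁ (Ξ x) x∈F | proj₁ (Ξ y) y∈F
  ... | inj₂ (x∈U , _) | _ = ⊥-elim (x∉U x∈U)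
  ... | inj₁ _ | inj₁ (y∈L , _) = ⊥-elim (y∉L y∈L)
  ... | inj₁ (_ , x≼m) | inj₂ (_ , m≼y) = ≼-trans x≼m m≼y

module _ {n : ℕ} (P : FinPoset n) (Z : Subset n) where
  open FinPoset P
  open IsDecPartialOrder isDecPartialOrder using (reflexive)
    renaming (_≤?_ to _≼?_; refl to ≼-refl; trans to ≼-trans)

  infix 4 _≺ᶜ_ _≼ᶜ_ _≺ᶜ?_

  _≺ᶜ_ : Fin n → Fin n → Set
  _≺ᶜ_ = _≺C_ P Z

  _≼ᶜ_ : Fin n → Fin n → Set
  _≼ᶜ_ = _≼C_ P Z

  LC : Fin n → Set
  LC = InLC P Z

  UC : Fin n → Set
  UC = InUC P Z

  _≺ᶜ?_ : ∀ x y → Dec (x ≺ᶜ y)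
  x ≺ᶜ? y = (x ∈? Z) ×-dec (y ∈? Z) ×-dec _≺?_ P x y

  LC? : Decidable LC
  LC? x = (x ∈? Z) ×-dec all? (λ y → (y ∈? Z) →-dec ((y ≼? x) →-dec (y ≟ x)))

  UC? : Decidable UC
  UC? x = (x ∈? Z) ×-dec all? (λ y → (y ∈? Z) →-dec ((x ≼? y) →-dec (y ≟ x)))

  ≺ᶜ⇒≼ᶜ : ∀ {x y} → x ≺ᶜ y → x ≼ᶜ y
  ≺ᶜ⇒≼ᶜ (x∈Z , y∈Z , x≼y , _) = x∈Z , y∈Z , x≼y

  ≼ᶜ-refl : ∀ {x} → x ∈ Z → x ≼ᶜ x
  ≼ᶜ-refl x∈Z = x∈Z , x∈Z , ≼-refl

  LC-minimal : ∀ {x y} → LC x → y ≼ᶜ x → y ≡ x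
  LC-minimal (_ , minimal) (y∈Z , _ , y≼x) = minimal _ y∈Z y≼x

  UC-maximal : ∀ {x y} → UC x → x ≼ᶜ y → y ≡ x
  UC-maximal (_ , maximal) (_ , y∈Z , x≼y) = maximal _ y∈Z x≼y

  InL⇒LC : ∀ {x} → x ∈ Z → InL P x → LC x
  InL⇒LC x∈Z x∈L = x∈Z , λ y _ → x∈L y

  InU⇒UC : ∀ {x} → x ∈ Z → InU P x → UC x
  InU⇒UC x∈Z x∈U = x∈Z , λ y _ → x∈U y

  Curlyvee-∋ : ∀ {a S} → Curlyvee P Z a S → a ∈ S
  Curlyvee-∋ {a} (_ , _ , _ , refl) = x∈p∪q⁺ (inj₁ (x∈⁅x⁆ a))

  Curlywedge-∋ : ∀ {v S} → Curlywedge P Z v S → v ∈ S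
  Curlywedge-∋ {v} (_ , _ , _ , refl) = x∈p∪q⁺ (inj₁ (x∈⁅x⁆ v))

  Curlyvee-triple : ∀ {b t u} → UC t → UC u → Curlyvee P Z b (triple b t u)
  Curlyvee-triple {t = t} t∈U u∈U =
    pair _ _ , (t , x∈p∪q⁺ (inj₁ (x∈⁅x⁆ t))) , pair-all UC t∈U u∈U , refl

  Curlywedge-triple : ∀ {t b c} → LC b → LC c → Curlywedge P Z t (triple t b c)
  Curlywedge-triple {b = b} b∈L c∈L =
    pair _ _ , (b , x∈p∪q⁺ (inj₁ (x∈⁅x⁆ b))) , pair-all LC b∈L c∈L , refl

  InLfam-unique : ∀ {x₀ T} → (∀ a → LC a → a ≡ x₀) → ∀ a → LC a → InLfam P Z T → Curlyvee P Z a T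
  InLfam-unique {T = T} unique a a∈L (a′ , a′∈L , a′-vee) =
    subst (λ z → Curlyvee P Z z T) (trans (unique a′ a′∈L) (sym (unique a a∈L))) a′-vee

  InUfam-unique : ∀ {y₀ T} → (∀ v → UC v → v ≡ y₀) → ∀ v → UC v → InUfam P Z T → Curlywedge P Z v T
  InUfam-unique {T = T} unique v v∈U (v′ , v′∈U , v′-wedge) =
    subst (λ z → Curlywedge P Z z T) (trans (unique v′ v′∈U) (sym (unique v v∈U))) v′-wedge

  PathC-invariant : (I : Pred (Fin n) ℓ) →
    (∀ {z w} → z ∈ Z → w ∈ Z → I z → Comparable P z w → I w) →
    ∀ {z w} → PathC P Z z w → z ∈ Z → I z → I w
  PathC-invariant I closed here _ Iz = Iz
  PathC-invariant I closed (step z~y y∈Z path) z∈Z Iz =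
    PathC-invariant I closed path y∈Z (closed z∈Z y∈Z Iz z~y)

  PathC-leaves : ∀ {x w} → PathC P Z x w → x ≢ w → ∃[ y ] (y ∈ Z × y ≢ x × Comparable P x y)
  PathC-leaves here x≢x = ⊥-elim (x≢x refl)
  PathC-leaves {x} (step {y = y} x~y y∈Z path) x≢w with y ≟ x
  ... | yes refl = PathC-leaves path x≢w
  ... | no y≢x = y , y∈Z , y≢x , x~y

  common-points⇒ImageClique : ∀ {φ b t} → LC b → UC t →
    (∀ F → InFP P F → b ∈ φ F × t ∈ φ F) → ImageClique P Z φ
  common-points⇒ImageClique b∈L t∈U common F G F∈ G∈ =
    (_ , b∈L , proj₁ (common F F∈) , proj₁ (common G G∈)) ,
    (_ , t∈U , proj₂ (common F F∈) , proj₂ (common G G∈))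

  ImageClique⇒IsHom : ∀ {φ} → (∀ F → InFP P F → InC0 P Z (φ F)) → ImageClique P Z φ → IsHom P Z φ
  ImageClique⇒IsHom C₀ clique =
    C₀ , (λ F G F∈ G∈ _ → proj₁ (clique F G F∈ G∈)) , (λ F G F∈ G∈ _ → proj₂ (clique F G F∈ G∈))

  SeparatingL SeparatingU : (Subset n → Subset n) → (Fin n → Fin n) → Set
  SeparatingL φ i = ∀ a F → LC a → InFP P F → i a ∈ F → InLfam P Z (φ F) → Curlyvee P Z a (φ F)
  SeparatingU φ i = ∀ v F → UC v → InFP P F → i v ∈ F → InUfam P Z (φ F) → Curlywedge P Z v (φ F)

  C𝓕⊆N : Fin n → Fin n → Set
  C𝓕⊆N a v = ∀ x y → CFRel P Z x y → NRel P Z a v x y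

  HasSeparatingCliqueHom : Set
  HasSeparatingCliqueHom = ∃[ φ ] (IsHom P Z φ × ZSeparating P Z φ × ImageClique P Z φ)

  BranchingEdge : Fin n → Fin n → Set
  BranchingEdge b t = b ≺ᶜ t × (∃[ u ] (b ≺ᶜ u × u ≢ t)) × (∃[ c ] (c ≺ᶜ t × c ≢ b))

  branchingEdge? : Dec (∃[ b ] ∃[ t ] BranchingEdge b t)
  branchingEdge? = any? λ b → any? λ t → b ≺ᶜ? t ×-dec
    any? (λ u → b ≺ᶜ? u ×-dec ¬? (u ≟ t)) ×-dec any? (λ c → c ≺ᶜ? t ×-dec ¬? (c ≟ b))

  module HeightOne (h1 : HeightOneC P Z) where

    ≺ᶜ⇒LC : ∀ {x y} → x ≺ᶜ y → LC x
    ≺ᶜ⇒LC {x} {y} x≺y@(x∈Z , _) = x∈Z , minimal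
      where
      minimal : ∀ z → z ∈ Z → z ≼ x → z ≡ x
      minimal z z∈Z z≼x with z ≟ x
      ... | yes z≡x = z≡x
      ... | no z≢x = ⊥-elim (proj₂ h1 (z , x , y , (z∈Z , x∈Z , z≼x , z≢x) , x≺y))

    ≺ᶜ⇒UC : ∀ {x y} → x ≺ᶜ y → UC y
    ≺ᶜ⇒UC {x} {y} x≺y@(_ , y∈Z , _) = y∈Z , maximal
      where
      maximal : ∀ z → z ∈ Z → y ≼ z → z ≡ y
      maximal z z∈Z y≼z with z ≟ y
      ... | yes z≡y = z≡y
      ... | no z≢y = ⊥-elim (proj₂ h1 (x , y , z , x≺y , (y∈Z , z∈Z , y≼z , z≢y ∘ sym)))

    InC0-triple-above : ∀ {b t u} → b ≺ᶜ t → b ≺ᶜ u → InC0 P Z (triple b t u)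
    InC0-triple-above {b} b≺t b≺u =
      inj₁ ((b , b∈L , Curlyvee-triple (≺ᶜ⇒UC b≺t) (≺ᶜ⇒UC b≺u)) ,
            (b , b∈L , triple-all (b ≼ᶜ_) (≼ᶜ-refl (proj₁ b≺t)) (≺ᶜ⇒≼ᶜ b≺t) (≺ᶜ⇒≼ᶜ b≺u)))
      where
      b∈L : LC b
      b∈L = ≺ᶜ⇒LC b≺t

    InC0-triple-below : ∀ {t b c} → b ≺ᶜ t → c ≺ᶜ t → InC0 P Z (triple t b c)
    InC0-triple-below {t} b≺t c≺t =
      inj₂ ((t , t∈U , Curlywedge-triple (≺ᶜ⇒LC b≺t) (≺ᶜ⇒LC c≺t)) ,
            (t , t∈U , triple-all (_≼ᶜ t) (≼ᶜ-refl (proj₁ (proj₂ b≺t))) (≺ᶜ⇒≼ᶜ b≺t) (≺ᶜ⇒≼ᶜ c≺t)))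
      where
      t∈U : UC t
      t∈U = ≺ᶜ⇒UC b≺t

  module Connected (conn : ConnectedC P Z) (h1 : HeightOneC P Z) where
    open HeightOne h1

    x₀ y₀ : Fin n
    x₀ = proj₁ (proj₁ h1)
    y₀ = proj₁ (proj₂ (proj₁ h1))

    x₀≺y₀ : x₀ ≺ᶜ y₀
    x₀≺y₀ = proj₂ (proj₂ (proj₁ h1))

    x₀∈L : LC x₀
    x₀∈L = ≺ᶜ⇒LC x₀≺y₀

    y₀∈U : UC y₀
    y₀∈U = ≺ᶜ⇒UC x₀≺y₀

    has-neighbour : ∀ {x} → x ∈ Z → ∃[ y ] (y ∈ Z × y ≢ x × Comparable P x y)
    has-neighbour {x} x∈Z with x ≟ x₀
    ... | yes refl =
      PathC-leaves (proj₂ conn x y₀ x∈Z (proj₁ (proj₂ x₀≺y₀))) (proj₂ (proj₂ (proj₂ x₀≺y₀)))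
    ... | no x≢x₀ = PathC-leaves (proj₂ conn x x₀ x∈Z (proj₁ x₀≺y₀)) x≢x₀

    has-upper : ∀ {x} → LC x → ∃[ y ] (x ≺ᶜ y)
    has-upper x∈L@(x∈Z , _) with has-neighbour x∈Z
    ... | y , y∈Z , y≢x , inj₁ x≼y = y , x∈Z , y∈Z , x≼y , y≢x ∘ sym
    ... | y , y∈Z , y≢x , inj₂ y≼x = ⊥-elim (y≢x (LC-minimal x∈L (y∈Z , x∈Z , y≼x)))

    has-lower : ∀ {y} → UC y → ∃[ x ] (x ≺ᶜ y)
    has-lower y∈U@(y∈Z , _) with has-neighbour y∈Z
    ... | x , x∈Z , x≢y , inj₂ x≼y = x , x∈Z , y∈Z , x≼y , x≢y
    ... | x , x∈Z , x≢y , inj₁ y≼x = ⊥-elim (x≢y (UC-maximal y∈U (y∈Z , x∈Z , y≼x)))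

    LC≢UC : ∀ {x y} → LC x → UC y → x ≢ y
    LC≢UC x∈L y∈U refl with has-upper x∈L
    ... | z , x≺z = proj₂ (proj₂ (proj₂ x≺z)) (sym (UC-maximal y∈U (≺ᶜ⇒≼ᶜ x≺z)))

    LC⇒¬InU : ∀ {x} → LC x → ¬ InU P x
    LC⇒¬InU x∈L x∈U with has-upper x∈L
    ... | y , (_ , _ , x≼y , x≢y) = x≢y (sym (x∈U _ x≼y))

    UC⇒¬InL : ∀ {y} → UC y → ¬ InL P y
    UC⇒¬InL y∈U y∈L with has-lower y∈U
    ... | x , (_ , _ , x≼y , x≢y) = x≢y (y∈L _ x≼y)

    𝓕-related : ∀ {F x y} → InFP P F → x ∈ F → y ∈ F → LC x → UC y → x ≺ᶜ y
    𝓕-related F∈ x∈F y∈F x∈L y∈U =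
      proj₁ x∈L , proj₁ y∈U , 𝓕-ordered P F∈ x∈F y∈F (LC⇒¬InU x∈L) (UC⇒¬InL y∈U) , LC≢UC x∈L y∈U

    ¬InUfam : ∀ {S t u} → UC t → UC u → t ≢ u → t ∈ S → u ∈ S → ¬ InUfam P Z S
    ¬InUfam t∈U u∈U t≢u t∈S u∈S (top , _ , N , _ , N⊆L , refl) =
      t≢u (trans (is-top t∈U t∈S) (sym (is-top u∈U u∈S)))
      where
      is-top : ∀ {x} → UC x → x ∈ ⁅ top ⁆ ∪ N → x ≡ top
      is-top x∈U x∈S with x∈p∪q⁻ ⁅ top ⁆ N x∈S
      ... | inj₁ x∈top = x∈⁅y⁆⇒x≡y top x∈top
      ... | inj₂ x∈N = ⊥-elim (LC≢UC (N⊆L _ x∈N) x∈U refl)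

    ¬InLfam : ∀ {S b c} → LC b → LC c → b ≢ c → b ∈ S → c ∈ S → ¬ InLfam P Z S
    ¬InLfam b∈L c∈L b≢c b∈S c∈S (bottom , _ , N , _ , N⊆U , refl) =
      b≢c (trans (is-bottom b∈L b∈S) (sym (is-bottom c∈L c∈S)))
      where
      is-bottom : ∀ {x} → LC x → x ∈ ⁅ bottom ⁆ ∪ N → x ≡ bottom
      is-bottom x∈L x∈S with x∈p∪q⁻ ⁅ bottom ⁆ N x∈S
      ... | inj₁ x∈bottom = x∈⁅y⁆⇒x≡y bottom x∈bottom
      ... | inj₂ x∈N = ⊥-elim (LC≢UC x∈L (N⊆U _ x∈N) refl)

    module _ (¬branching : ¬ (∃[ b ] ∃[ t ] BranchingEdge b t)) {b t : Fin n} (b≺t : b ≺ᶜ t) where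

      sole-upper : ¬ (∃[ u ] (b ≺ᶜ u × u ≢ t)) → ∀ {z w} → z ≺ᶜ t → z ≺ᶜ w → w ≡ t
      sole-upper ¬up {z} {w} z≺t z≺w with w ≟ t
      ... | yes w≡t = w≡t
      ... | no w≢t with z ≟ b
      ...   | yes refl = ⊥-elim (¬up (w , z≺w , w≢t))
      ...   | no z≢b = ⊥-elim (¬branching (z , t , z≺t , (w , z≺w , w≢t) , (b , b≺t , z≢b ∘ sym)))

      sole-lower : ¬ (∃[ c ] (c ≺ᶜ t × c ≢ b)) → ∀ {z w} → b ≺ᶜ z → w ≺ᶜ z → w ≡ b
      sole-lower ¬down {z} {w} b≺z w≺z with w ≟ b
      ... | yes w≡b = w≡b
      ... | no w≢b with z ≟ t
      ...   | yes refl = ⊥-elim (¬down (w , w≺z , w≢b))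
      ...   | no z≢t = ⊥-elim (¬branching (b , z , b≺z , (t , b≺t , z≢t ∘ sym) , (w , w≺z , w≢b)))

      UC-unique : ¬ (∃[ u ] (b ≺ᶜ u × u ≢ t)) → ∀ v → UC v → v ≡ t
      UC-unique ¬up v v∈U = sym (UC-maximal v∈U (proj₁ v∈U , t∈Z , v≼t))
        where
        t∈Z : t ∈ Z
        t∈Z = proj₁ (proj₂ b≺t)

        closed : ∀ {z w} → z ∈ Z → w ∈ Z → z ≼ t → Comparable P z w → w ≼ t
        closed _ _ z≼t (inj₂ w≼z) = ≼-trans w≼z z≼t
        closed {z} {w} z∈Z w∈Z z≼t (inj₁ z≼w) with z ≟ t | w ≟ z
        ... | yes refl | _ = reflexive (UC-maximal (≺ᶜ⇒UC b≺t) (z∈Z , w∈Z , z≼w))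
        ... | no _ | yes refl = z≼t
        ... | no z≢t | no w≢z =
          reflexive (sole-upper ¬up (z∈Z , t∈Z , z≼t , z≢t) (z∈Z , w∈Z , z≼w , w≢z ∘ sym))

        v≼t : v ≼ t
        v≼t = PathC-invariant (_≼ t) closed (proj₂ conn t v t∈Z (proj₁ v∈U)) t∈Z ≼-refl

      LC-unique : ¬ (∃[ c ] (c ≺ᶜ t × c ≢ b)) → ∀ a → LC a → a ≡ b
      LC-unique ¬down a a∈L = sym (LC-minimal a∈L (b∈Z , proj₁ a∈L , b≼a))
        where
        b∈Z : b ∈ Z
        b∈Z = proj₁ b≺t

        closed : ∀ {z w} → z ∈ Z → w ∈ Z → b ≼ z → Comparable P z w → b ≼ w
        closed _ _ b≼z (inj₁ z≼w) = ≼-trans b≼z z≼w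
        closed {z} {w} z∈Z w∈Z b≼z (inj₂ w≼z) with z ≟ b | w ≟ z
        ... | yes refl | _ = reflexive (sym (LC-minimal (≺ᶜ⇒LC b≺t) (w∈Z , z∈Z , w≼z)))
        ... | no _ | yes refl = b≼z
        ... | no z≢b | no w≢z =
          reflexive (sym (sole-lower ¬down (b∈Z , z∈Z , b≼z , z≢b ∘ sym) (w∈Z , z∈Z , w≼z , w≢z)))

        b≼a : b ≼ a
        b≼a = PathC-invariant (b ≼_) closed (proj₂ conn b a b∈Z (proj₁ a∈L)) b∈Z ≼-refl

  module Criterion (EZ : ∀ x → x ∈ Z → InE P x) (conn : ConnectedC P Z) (h1 : HeightOneC P Z) where
    open HeightOne h1
    open Connected conn h1

    LC⇒InL : ∀ {x} → LC x → InL P x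
    LC⇒InL {x} x∈L with EZ x (proj₁ x∈L)
    ... | inj₁ x∈L′ = x∈L′
    ... | inj₂ x∈U = ⊥-elim (LC⇒¬InU x∈L x∈U)

    UC⇒InU : ∀ {x} → UC x → InU P x
    UC⇒InU {x} x∈U with EZ x (proj₁ x∈U)
    ... | inj₁ x∈L = ⊥-elim (UC⇒¬InL x∈U x∈L)
    ... | inj₂ x∈U′ = x∈U′

    LC⊎UC : ∀ {x} → x ∈ Z → LC x ⊎ UC x
    LC⊎UC {x} x∈Z with EZ x x∈Z
    ... | inj₁ x∈L = inj₁ (InL⇒LC x∈Z x∈L)
    ... | inj₂ x∈U = inj₂ (InU⇒UC x∈Z x∈U)

    module CliqueImage {φ : Subset n → Subset n} (clique : ImageClique P Z φ) where

      bottom∈every-image : ∀ {F a₀} → InFP P F → (∀ z → z ∈ φ F → a₀ ≼ᶜ z) →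
                           ∀ G → InFP P G → a₀ ∈ φ G
      bottom∈every-image {F} F∈ a₀≼ G G∈ with proj₁ (clique F G F∈ G∈)
      ... | z , z∈L , z∈φF , z∈φG = subst (_∈ φ G) (sym (LC-minimal z∈L (a₀≼ z z∈φF))) z∈φG

      top∈every-image : ∀ {F v₀} → InFP P F → (∀ z → z ∈ φ F → z ≼ᶜ v₀) →
                        ∀ G → InFP P G → v₀ ∈ φ G
      top∈every-image {F} F∈ ≼v₀ G G∈ with proj₂ (clique F G F∈ G∈)
      ... | z , z∈U , z∈φF , z∈φG = subst (_∈ φ G) (sym (UC-maximal z∈U (≼v₀ z z∈φF))) z∈φG

      common-bottom : ∃[ a ] (LC a ×
        ∀ {F a₀} → InFP P F → LC a₀ → (∀ z → z ∈ φ F → a₀ ≼ᶜ z) → a₀ ≡ a)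
      common-bottom with any? (λ c → LC? c ×-dec allSubset? (λ G → InFP? P G →-dec (c ∈? φ G)))
      ... | yes (c , c∈L , c∈all) = c , c∈L , λ F∈ _ a₀≼ → LC-minimal c∈L (a₀≼ c (c∈all _ F∈))
      ... | no ∄ = x₀ , x₀∈L , λ F∈ a₀∈L a₀≼ →
        ⊥-elim (∄ (_ , a₀∈L , bottom∈every-image F∈ a₀≼))

      common-top : ∃[ v ] (UC v ×
        ∀ {F v₀} → InFP P F → UC v₀ → (∀ z → z ∈ φ F → z ≼ᶜ v₀) → v₀ ≡ v)
      common-top with any? (λ c → UC? c ×-dec allSubset? (λ G → InFP? P G →-dec (c ∈? φ G)))
      ... | yes (c , c∈U , c∈all) = c , c∈U , λ F∈ _ ≼v₀ → UC-maximal c∈U (≼v₀ c (c∈all _ F∈))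
      ... | no ∄ = y₀ , y₀∈U , λ F∈ v₀∈U ≼v₀ →
        ⊥-elim (∄ (_ , v₀∈U , top∈every-image F∈ ≼v₀))

    module Separated (φ : Subset n → Subset n) (i : Fin n → Fin n)
                     (C₀ : ∀ F → InFP P F → InC0 P Z (φ F))
                     (i-L : ∀ a → LC a → InL P (i a)) (i-U : ∀ v → UC v → InU P (i v))
                     (sepL : SeparatingL φ i) (sepU : SeparatingU φ i)
                     (i-Z : ∀ x → x ∈ Z → i x ∈ Z) (i-onto : ∀ y → y ∈ Z → ∃[ x ] (x ∈ Z × i x ≡ y))
                     (clique : ImageClique P Z φ) where
      open CliqueImage clique

      i-LC : ∀ {a} → LC a → LC (i a)
      i-LC {a} a∈L = InL⇒LC (i-Z a (proj₁ a∈L)) (i-L a a∈L)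

      i-UC : ∀ {v} → UC v → UC (i v)
      i-UC {v} v∈U = InU⇒UC (i-Z v (proj₁ v∈U)) (i-U v v∈U)

      LC-preimage : ∀ {y} → LC y → ∃[ x ] (LC x × i x ≡ y)
      LC-preimage y∈L with i-onto _ (proj₁ y∈L)
      ... | x , x∈Z , ix≡y with LC⊎UC x∈Z
      ...   | inj₁ x∈L = x , x∈L , ix≡y
      ...   | inj₂ x∈U = ⊥-elim (LC≢UC y∈L (i-UC x∈U) (sym ix≡y))

      UC-preimage : ∀ {y} → UC y → ∃[ x ] (UC x × i x ≡ y)
      UC-preimage y∈U with i-onto _ (proj₁ y∈U)
      ... | x , x∈Z , ix≡y with LC⊎UC x∈Z
      ...   | inj₁ x∈L = ⊥-elim (LC≢UC (i-LC x∈L) y∈U ix≡y)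
      ...   | inj₂ x∈U = x , x∈U , ix≡y

      LC∈F≡i-bottom : ∀ {F a₀ x} → InFP P F → InLfam P Z (φ F) → (∀ z → z ∈ φ F → a₀ ≼ᶜ z) →
                      LC x → x ∈ F → x ≡ i a₀
      LC∈F≡i-bottom F∈ lfam a₀≼ x∈L x∈F with LC-preimage x∈L
      ... | x′ , x′∈L , refl =
        cong i (sym (LC-minimal x′∈L (a₀≼ x′ (Curlyvee-∋ (sepL x′ _ x′∈L F∈ x∈F lfam)))))

      UC∈F≡i-top : ∀ {F v₀ y} → InFP P F → InUfam P Z (φ F) → (∀ z → z ∈ φ F → z ≼ᶜ v₀) →
                   UC y → y ∈ F → y ≡ i v₀
      UC∈F≡i-top F∈ ufam ≼v₀ y∈U y∈F with UC-preimage y∈U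
      ... | y′ , y′∈U , refl =
        cong i (sym (UC-maximal y′∈U (≼v₀ y′ (Curlywedge-∋ (sepU y′ _ y′∈U F∈ y∈F ufam)))))

      C𝓕⊆N-witness : ∃[ a ] ∃[ v ] (LC a × UC v × C𝓕⊆N a v)
      C𝓕⊆N-witness with common-bottom | common-top
      ... | a , a∈L , a-unique | v , v∈U , v-unique = i a , i v , i-LC a∈L , i-UC v∈U , cover
        where
        cover : C𝓕⊆N (i a) (i v)
        cover x y (x≺y , F , F∈ , x∈F , y∈F) with C₀ F F∈
        ... | inj₁ (lfam , a₀ , a₀∈L , a₀≼) =
          inj₂ ( trans (LC∈F≡i-bottom F∈ lfam a₀≼ (≺ᶜ⇒LC x≺y) x∈F) (cong i (a-unique F∈ a₀∈L a₀≼))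
               , ≺ᶜ⇒UC x≺y)
        ... | inj₂ (ufam , v₀ , v₀∈U , ≼v₀) =
          inj₁ ( ≺ᶜ⇒LC x≺y
               , trans (UC∈F≡i-top F∈ ufam ≼v₀ (≺ᶜ⇒UC x≺y) y∈F) (cong i (v-unique F∈ v₀∈U ≼v₀)))

    forward : HasSeparatingCliqueHom → ∃[ a ] ∃[ v ] (LC a × UC v × C𝓕⊆N a v)
    forward (φ , (C₀ , _) , (_ , i , (_ , _ , i-L , i-U , sepL , sepU) , i-Z , i-onto) , clique) =
      Separated.C𝓕⊆N-witness φ i C₀ i-L i-U sepL sepU i-Z i-onto clique

    permutation-ZSeparating : ∀ {φ} (π : Permutation′ n) →
      (∀ {x} → x ∈ Z → π ⟨$⟩ʳ x ∈ Z) → (∀ {x} → x ∈ Z → π ⟨$⟩ˡ x ∈ Z) →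
      (∀ {a} → LC a → LC (π ⟨$⟩ʳ a)) → (∀ {v} → UC v → UC (π ⟨$⟩ʳ v)) →
      SeparatingL φ (π ⟨$⟩ʳ_) → SeparatingU φ (π ⟨$⟩ʳ_) → ZSeparating P Z φ
    permutation-ZSeparating π π-Z π⁻¹-Z π-LC π-UC sepL sepU =
      EZ , (π ⟨$⟩ʳ_) ,
      ((λ _ _ _ _ → Injection.injective (↔⇒↣ π)) , (λ _ x∈Z → EZ _ (π-Z x∈Z)) ,
       (λ _ a∈L → LC⇒InL (π-LC a∈L)) , (λ _ v∈U → UC⇒InU (π-UC v∈U)) , sepL , sepU) ,
      (λ _ → π-Z) , (λ y y∈Z → π ⟨$⟩ˡ y , π⁻¹-Z y∈Z , inverseʳ π)

    hom-from-common-points : ∀ {φ b t} → LC b → UC t →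
      (∀ F → InFP P F → b ∈ φ F × t ∈ φ F × InC0 P Z (φ F)) →
      ZSeparating P Z φ → HasSeparatingCliqueHom
    hom-from-common-points {φ} b∈L t∈U common sep =
      φ , ImageClique⇒IsHom (λ F F∈ → proj₂ (proj₂ (common F F∈))) clique , sep , clique
      where
      clique : ImageClique P Z φ
      clique = common-points⇒ImageClique b∈L t∈U
        (λ F F∈ → proj₁ (common F F∈) , proj₁ (proj₂ (common F F∈)))

    constant-hom : ∀ {b t} (T : Subset n) → LC b → UC t → b ∈ T → t ∈ T → InC0 P Z T →
      (∀ a → LC a → InLfam P Z T → Curlyvee P Z a T) →
      (∀ v → UC v → InUfam P Z T → Curlywedge P Z v T) → HasSeparatingCliqueHom
    constant-hom T b∈L t∈U b∈T t∈T T∈C₀ vee wedge =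
      hom-from-common-points {φ = λ _ → T} b∈L t∈U (λ _ _ → b∈T , t∈T , T∈C₀)
        (permutation-ZSeparating Permutation.id id id id id
          (λ a _ a∈L _ _ → vee a a∈L) (λ v _ v∈U _ _ → wedge v v∈U))

    module Branching {a v : Fin n} (a∈L : LC a) (v∈U : UC v) (cover : C𝓕⊆N a v)
                     {b t u c : Fin n} (b≺t : b ≺ᶜ t) (b≺u : b ≺ᶜ u) (u≢t : u ≢ t)
                     (c≺t : c ≺ᶜ t) (c≢b : c ≢ b) where

      b∈L : LC b
      b∈L = ≺ᶜ⇒LC b≺t

      c∈L : LC c
      c∈L = ≺ᶜ⇒LC c≺t

      t∈U : UC t
      t∈U = ≺ᶜ⇒UC b≺t

      u∈U : UC u
      u∈U = ≺ᶜ⇒UC b≺u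

      π : Permutation′ n
      π = transpose v t ∘ₚ transpose a b

      i : Fin n → Fin n
      i = π ⟨$⟩ʳ_

      i-b : i b ≡ a
      i-b = trans (cong (PC.transpose a b) (transpose-fix (LC≢UC b∈L v∈U) (LC≢UC b∈L t∈U)))
                  (transpose-matchʳ a b)

      i-t : i t ≡ v
      i-t = trans (cong (PC.transpose a b) (transpose-matchʳ v t))
                  (transpose-fix (LC≢UC a∈L v∈U ∘ sym) (LC≢UC b∈L v∈U ∘ sym))

      i-injective : ∀ {x y} → i x ≡ i y → x ≡ y
      i-injective = Injection.injective (↔⇒↣ π)

      i-Z : ∀ {x} → x ∈ Z → i x ∈ Z
      i-Z = transpose-preserves (_∈ Z) (proj₁ a∈L) (proj₁ b∈L)
          ∘ transpose-preserves (_∈ Z) (proj₁ v∈U) (proj₁ t∈U)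

      i⁻¹-Z : ∀ {x} → x ∈ Z → π ⟨$⟩ˡ x ∈ Z
      i⁻¹-Z = transpose-preserves (_∈ Z) (proj₁ t∈U) (proj₁ v∈U)
            ∘ transpose-preserves (_∈ Z) (proj₁ b∈L) (proj₁ a∈L)

      i-LC : ∀ {x} → LC x → LC (i x)
      i-LC x∈L = subst (LC ∘ PC.transpose a b) (sym (transpose-fix (LC≢UC x∈L v∈U) (LC≢UC x∈L t∈U)))
                       (transpose-preserves LC a∈L b∈L x∈L)

      i-UC : ∀ {x} → UC x → UC (i x)
      i-UC {x} x∈U = subst UC (sym (transpose-fix (LC≢UC a∈L y∈U ∘ sym) (LC≢UC b∈L y∈U ∘ sym))) y∈U
        where
        y∈U : UC (PC.transpose v t x)
        y∈U = transpose-preserves UC v∈U t∈U x∈U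

      MeetsLC∖a : Pred (Subset n) _
      MeetsLC∖a F = ∃[ x ] (x ∈ F × LC x × x ≢ a)

      meets? : Decidable MeetsLC∖a
      meets? F = any? λ x → (x ∈? F) ×-dec LC? x ×-dec ¬? (x ≟ a)

      select : ∀ {F} → Dec (MeetsLC∖a F) → Subset n
      select (yes _) = triple t b c
      select (no _) = triple b t u

      φ : Subset n → Subset n
      φ F = select (meets? F)

      common : ∀ F → InFP P F → b ∈ φ F × t ∈ φ F × InC0 P Z (φ F)
      common F _ with meets? F
      ... | yes _ = q∈triple , p∈triple , InC0-triple-below b≺t c≺t
      ... | no _ = p∈triple , q∈triple , InC0-triple-above b≺t b≺u

      sepL : SeparatingL φ i
      sepL a′ F a′∈L _ ia′∈F lfam with meets? F
      ... | yes _ = ⊥-elim (¬InLfam b∈L c∈L (c≢b ∘ sym) q∈triple r∈triple lfam)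
      ... | no ¬meets =
        subst (λ z → Curlyvee P Z z (triple b t u)) (sym a′≡b) (Curlyvee-triple t∈U u∈U)
        where
        ia′≡a : i a′ ≡ a
        ia′≡a = decidable-stable (i a′ ≟ a) λ ia′≢a → ¬meets (i a′ , ia′∈F , i-LC a′∈L , ia′≢a)

        a′≡b : a′ ≡ b
        a′≡b = i-injective (trans ia′≡a (sym i-b))

      sepU : SeparatingU φ i
      sepU v′ F v′∈U F∈ iv′∈F ufam with meets? F
      ... | no _ = ⊥-elim (¬InUfam t∈U u∈U (u≢t ∘ sym) q∈triple r∈triple ufam)
      ... | yes (x , x∈F , x∈L , x≢a)
        with cover x (i v′) (𝓕-related F∈ x∈F iv′∈F x∈L (i-UC v′∈U) , F , F∈ , x∈F , iv′∈F)
      ...   | inj₂ (x≡a , _) = ⊥-elim (x≢a x≡a)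
      ...   | inj₁ (_ , iv′≡v) =
        subst (λ z → Curlywedge P Z z (triple t b c))
              (sym (i-injective (trans iv′≡v (sym i-t)))) (Curlywedge-triple b∈L c∈L)

      hom : HasSeparatingCliqueHom
      hom = hom-from-common-points b∈L t∈U common
              (permutation-ZSeparating π i-Z i⁻¹-Z i-LC i-UC sepL sepU)

    -- The three cases: C is a star centred at x₀, a star centred at y₀, or the edge x₀ < y₀.
    star-hom : ¬ (∃[ b ] ∃[ t ] BranchingEdge b t) → HasSeparatingCliqueHom
    star-hom ¬br with any? (λ u → x₀ ≺ᶜ? u ×-dec ¬? (u ≟ y₀))
    ... | yes (u , x₀≺u , u≢y₀) =
      constant-hom (triple x₀ y₀ u) x₀∈L y₀∈U p∈triple q∈triple (InC0-triple-above x₀≺y₀ x₀≺u)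
        (InLfam-unique (LC-unique ¬br x₀≺y₀ λ lower →
          ¬br (x₀ , y₀ , x₀≺y₀ , (u , x₀≺u , u≢y₀) , lower)))
        (λ _ _ ufam → ⊥-elim (¬InUfam y₀∈U (≺ᶜ⇒UC x₀≺u) (u≢y₀ ∘ sym) q∈triple r∈triple ufam))
    ... | no ¬up with any? (λ c → c ≺ᶜ? y₀ ×-dec ¬? (c ≟ x₀))
    ...   | yes (c , c≺y₀ , c≢x₀) =
      constant-hom (triple y₀ x₀ c) x₀∈L y₀∈U q∈triple p∈triple (InC0-triple-below x₀≺y₀ c≺y₀)
        (λ _ _ lfam → ⊥-elim (¬InLfam x₀∈L (≺ᶜ⇒LC c≺y₀) (c≢x₀ ∘ sym) q∈triple r∈triple lfam))
        (InUfam-unique (UC-unique ¬br x₀≺y₀ ¬up))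
    ...   | no ¬down =
      constant-hom (triple x₀ y₀ y₀) x₀∈L y₀∈U p∈triple q∈triple (InC0-triple-above x₀≺y₀ x₀≺y₀)
        (InLfam-unique (LC-unique ¬br x₀≺y₀ ¬down)) (InUfam-unique (UC-unique ¬br x₀≺y₀ ¬up))

    backward : ∃[ a ] ∃[ v ] (LC a × UC v × C𝓕⊆N a v) → HasSeparatingCliqueHom
    backward (a , v , a∈L , v∈U , cover) with branchingEdge?
    ... | yes (b , t , b≺t , (u , b≺u , u≢t) , (c , c≺t , c≢b)) =
      Branching.hom a∈L v∈U cover b≺t b≺u u≢t c≺t c≢b
    ... | no ¬br = star-hom ¬br

proposition2 : ∀ {n : ℕ} (P : FinPoset n) (Z : Subset n) →
    2 ≤ n → NoIsolated P →
    (∀ x → x ∈ Z → InE P x) → ConnectedC P Z → HeightOneC P Z →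
    (∃[ φ ] (IsHom P Z φ × ZSeparating P Z φ × ImageClique P Z φ))
      ⇔ (∃[ a ] ∃[ v ] (InLC P Z a × InUC P Z v ×
           (∀ x y → CFRel P Z x y → NRel P Z a v x y)))
proposition2 P Z _ _ EZ conn h1 = mk⇔ forward backward
  where open Criterion P Z EZ conn h1
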